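{- Let $m,n\ge1$ and let $D=(T,\ell)\in\mathsf{LPara}_{m,n}$. Then its labelled bounce ribbon $B(D)=(\mathrm{bounce}(T),\ell')$ belongs to $\mathsf{LRib}_{m,n}$, and $D$ is uniquely determined by the pair $(B(D),\mathsf{surp}(D))$: if $D_1,D_2\in\mathsf{LPara}_{m,n}$ satisfy $B(D_1)=B(D_2)$ and $\mathsf{surp}(D_1)=\mathsf{surp}(D_2)$, then $D_1=D_2$.
   Context: All tableaux are $0/1$ arrays; $P_{ij}$ is the entry in row $i$ (top to bottom), column $j$ (left to right). Labels are symbols $v_0,\dots,v_{m+n-1}$ ordered by $v_i<v_j$ iff $i<j$. Parallelogram polyomino of type $(m,n)$: an $m\times n$ $0/1$ tableau $P$ with $P_{11}=P_{mn}=1$, every row containing at least one $1$ with the $1$s in each row contiguous, and for each $2\le i\le m$: the leftmost $1$ of row $i$ is weakly right of the leftmost $1$ of row $i-1$ and weakly left of the rightmost $1$ of row $i-1$, and the rightmost $1$ of row $i$ is weakly right of the rightmost $1$ of row $i-1$. A ribbon parallelogram polyomino is one with exactly $m+n-1$ ones. Labelled parallelogram polyomino: a pair $(P,\ell)$, $P$ a parallelogram polyomino of type $(m,n)$, $\ell$ assigning to the rows a permutation of $\{v_0,\dots,v_{m-1}\}$ with the top row labelled $v_0$ and labels of rows whose leftmost $1$s lie in the same column increasing from top to bottom, and to the columns a permutation of $\{v_m,\dots,v_{m+n-1}\}$ with labels of columns whose topmost $1$s lie in the same row increasing from left to right. $\mathsf{LPara}_{m,n}$ is the set of these, $\mathsf{LRib}_{m,n}$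 the subset with $P$ a ribbon. Bounce: for a parallelogram polyomino $P$, $\mathrm{bounce}(P)$ is the $0/1$ tableau whose $1$s are the cells visited by the path that starts at cell $(1,1)$, moves right to the rightmost $1$ of the current row, then down to the lowest $1$ of the current column, then right to the rightmost $1$ of the current row, and so on until reaching cell $(m,n)$. Labelled bounce ribbon: for $D=(T,\ell)\in\mathsf{LPara}_{m,n}$, $B(D)=(\mathrm{bounce}(T),\ell')$, where $\ell'$ is obtained as follows: partition the rows into maximal blocks of consecutive rows whose leftmost $1$ in $\mathrm{bounce}(T)$ lies in the same column; each block receives the same set of labels that $\ell$ gives to those rows, arranged increasingly from top to bottom; similarly, partition the columns into maximal blocks of consecutive columns whose topmost $1$ in $\mathrm{bounce}(T)$ lies in the same row; each block receives the set of labels $\ell$ gives to those columns, arranged increasingly from left to right. Surplus: $\mathsf{surp}(D)=(\mathsf{surp}_1,\dots,\mathsf{surp}_{m+n-1})$ where, for $1\le i\le m-1$, $\mathsf{surp}_i$ equals (the column index of the leftmost $1$ of the row labelled $v_i$ in $B(D)$) minus (the column index of the leftmost $1$ of the row labelled $v_i$ in $D$), and for $m\le i\le m+n-1$, $\mathsf{surp}_i$ equals (the row index of the topmost $1$ of the column labelled $v_i$ in $B(D)$) minus (the row index of the topmost $1$ of the column labelled $v_i$ in $D$). -}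

module Defs where

open import Data.Bool using (Bool; true; false; _∧_; _∨_; if_then_else_)
open import Data.Nat using (ℕ; zero; suc; _+_; _∸_; _≤_; _<_; _≤ᵇ_; _<ᵇ_; _≡ᵇ_; _⊓_; _⊔_)
open import Data.Integer using (ℤ; +_; _-_)
open import Data.Fin using (Fin; toℕ) renaming (zero to fzero)
open import Data.Vec using (Vec; []; _∷_; lookup; tabulate; replicate; map; _++_)
open import Data.List as List using (List; filterᵇ; allFin; length; upTo)
open import Data.Bool.ListAction using (all; any)
open import Data.Product using (_×_; _,_; proj₁; proj₂; ∃-syntax)
open import Function using (_∘_)
open import Function.Definitions using (Bijective)
open import Relation.Binary.PropositionalEquality using (_≡_)

-- Tableaux: m × n arrays of 0/1 (false/true), stored as a vector of rows.
-- Row/column indices below are 0-based natural numbers (row 0 = top row,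
-- column 0 = leftmost column).

Tab : ℕ → ℕ → Set
Tab m n = Vec (Vec Bool n) m

vget : {A : Set} {k : ℕ} → A → Vec A k → ℕ → A
vget d []       _       = d
vget d (x ∷ xs) zero    = x
vget d (x ∷ xs) (suc i) = vget d xs i

row : {m n : ℕ} → Tab m n → ℕ → Vec Bool n
row {n = n} P i = vget (replicate n false) P i

col : {m n : ℕ} → Tab m n → ℕ → Vec Bool m
col P j = map (λ r → vget false r j) P

entry : {m n : ℕ} → Tab m n → ℕ → ℕ → Bool
entry P i j = vget false (row P i) j

-- index of the first true entry (= length if there is none)
firstTrue : {k : ℕ} → Vec Bool k → ℕ
firstTrue []           = zero
firstTrue (true ∷ xs)  = zero
firstTrue (false ∷ xs) = suc (firstTrue xs)

anyTrue : {k : ℕ} → Vec Bool k → Bool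
anyTrue []       = false
anyTrue (x ∷ xs) = x ∨ anyTrue xs

-- index of the last true entry (only meaningful if there is one)
lastTrue : {k : ℕ} → Vec Bool k → ℕ
lastTrue []       = zero
lastTrue (x ∷ xs) = if anyTrue xs then suc (lastTrue xs) else zero

leftmost rightmost : {m n : ℕ} → Tab m n → ℕ → ℕ
leftmost  P i = firstTrue (row P i)
rightmost P i = lastTrue  (row P i)

topmost lowest : {m n : ℕ} → Tab m n → ℕ → ℕ
topmost P j = firstTrue (col P j)
lowest  P j = lastTrue  (col P j)

countTrue : {k : ℕ} → Vec Bool k → ℕ
countTrue []           = zero
countTrue (true ∷ xs)  = suc (countTrue xs)
countTrue (false ∷ xs) = countTrue xs

ones : {m n : ℕ} → Tab m n → ℕ
ones []       = zero
ones (r ∷ rs) = countTrue r + ones rs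

record IsParallelogram {m' n' : ℕ} (P : Tab (suc m') (suc n')) : Set where
  field
    corner-top    : entry P 0 0 ≡ true
    corner-bottom : entry P m' n' ≡ true
    row-nonempty  : ∀ i → i < suc m' → ∃[ j ] (j < suc n' × entry P i j ≡ true)
    row-contiguous : ∀ i → i < suc m' → ∀ j →
                     leftmost P i ≤ j → j ≤ rightmost P i → entry P i j ≡ true
    left-mono   : ∀ i → suc i < suc m' → leftmost P i ≤ leftmost P (suc i)
    left-bound  : ∀ i → suc i < suc m' → leftmost P (suc i) ≤ rightmost P i
    right-mono  : ∀ i → suc i < suc m' → rightmost P i ≤ rightmost P (suc i)

-- Labelled tableaux.  Row label  k : Fin m  stands for v_k;
-- column label  k : Fin n  stands for v_(m+k).

LTab : ℕ → ℕ → Set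
LTab m n = Tab m n × Vec (Fin m) m × Vec (Fin n) n

tab : {m n : ℕ} → LTab m n → Tab m n
tab = proj₁

rowLab : {m n : ℕ} → LTab m n → Vec (Fin m) m
rowLab D = proj₁ (proj₂ D)

colLab : {m n : ℕ} → LTab m n → Vec (Fin n) n
colLab D = proj₂ (proj₂ D)

record IsLPara {m' n' : ℕ} (D : LTab (suc m') (suc n')) : Set where
  field
    para      : IsParallelogram (tab D)
    rowPerm   : Bijective _≡_ _≡_ (lookup (rowLab D))
    colPerm   : Bijective _≡_ _≡_ (lookup (colLab D))
    topLabel  : lookup (rowLab D) fzero ≡ fzero
    rowIncr   : ∀ (i j : Fin (suc m')) → toℕ i < toℕ j →
                leftmost (tab D) (toℕ i) ≡ leftmost (tab D) (toℕ j) →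
                toℕ (lookup (rowLab D) i) < toℕ (lookup (rowLab D) j)
    colIncr   : ∀ (i j : Fin (suc n')) → toℕ i < toℕ j →
                topmost (tab D) (toℕ i) ≡ topmost (tab D) (toℕ j) →
                toℕ (lookup (colLab D) i) < toℕ (lookup (colLab D) j)

record IsLRib {m' n' : ℕ} (D : LTab (suc m') (suc n')) : Set where
  field
    lpara  : IsLPara D
    ribbon : ones (tab D) ≡ suc m' + suc n' ∸ 1

bstep : {m n : ℕ} → Tab m n → ℕ × ℕ → ℕ × ℕ
bstep P (r , c) = let c' = rightmost P r in (lowest P c' , c')

bcorner : {m n : ℕ} → Tab m n → ℕ → ℕ × ℕ
bcorner P zero    = (0 , 0)
bcorner P (suc k) = bstep P (bcorner P k)

inRange : ℕ → ℕ → ℕ → Bool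
inRange a x b = (a ≤ᵇ x) ∧ (x ≤ᵇ b)

onSeg : {m n : ℕ} → Tab m n → ℕ → ℕ → ℕ → Bool
onSeg P i j k with bcorner P k | bcorner P (suc k)
... | (r , c) | (r' , c') = ((i ≡ᵇ r) ∧ inRange c j c') ∨ ((j ≡ᵇ c') ∧ inRange r i r')

-- m + n iterations suffice (the path reaches (m-1,n-1) after at most m
-- steps and is stationary there)
bounce : {m n : ℕ} → Tab m n → Tab m n
bounce {m} {n} P =
  tabulate λ i → tabulate λ j → any (onSeg P (toℕ i) (toℕ j)) (upTo (m + n))

insertF : {k : ℕ} → Fin k → List (Fin k) → List (Fin k)
insertF x List.[] = x List.∷ List.[]
insertF x (y List.∷ ys) =
  if toℕ x ≤ᵇ toℕ y then x List.∷ y List.∷ ys else y List.∷ insertF x ys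

sortF : {k : ℕ} → List (Fin k) → List (Fin k)
sortF List.[]       = List.[]
sortF (x List.∷ xs) = insertF x (sortF xs)

nth : {A : Set} → A → List A → ℕ → A
nth d List.[]         _       = d
nth d (x List.∷ xs) zero    = x
nth d (x List.∷ xs) (suc i) = nth d xs i

sameBlock : {k : ℕ} → (ℕ → ℕ) → Fin k → Fin k → Bool
sameBlock {k} key i i' =
  all (λ t → if inRange (toℕ i ⊓ toℕ i') (toℕ t) (toℕ i ⊔ toℕ i')
             then key (toℕ t) ≡ᵇ key (toℕ i) else true)
      (allFin k)

relabel : {k : ℕ} → (ℕ → ℕ) → Vec (Fin (suc k)) (suc k) → Vec (Fin (suc k)) (suc k)
relabel {k} key lab = tabulate λ i →
  let blk  = filterᵇ (sameBlock key i) (allFin (suc k))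
      pos  = length (filterᵇ (λ i' → toℕ i' <ᵇ toℕ i) blk)
      labs = sortF (List.map (lookup lab) blk)
  in nth fzero labs pos

B : {m' n' : ℕ} → LTab (suc m') (suc n') → LTab (suc m') (suc n')
B (T , rl , cl) =
  (bounce T , relabel (leftmost (bounce T)) rl , relabel (topmost (bounce T)) cl)

posOf : {k : ℕ} → Vec (Fin k) k → ℕ → ℕ
posOf lab x = firstTrue (map (λ y → toℕ y ≡ᵇ x) lab)

surpRow : {m' n' : ℕ} → LTab (suc m') (suc n') → ℕ → ℤ
surpRow D x =
  (+ leftmost (tab (B D)) (posOf (rowLab (B D)) x))
    - (+ leftmost (tab D) (posOf (rowLab D) x))

-- surp_(m+x) for 0 ≤ x ≤ n-1 (column label v_(m+x))
surpCol : {m' n' : ℕ} → LTab (suc m') (suc n') → ℕ → ℤ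
surpCol D x =
  (+ topmost (tab (B D)) (posOf (colLab (B D)) x))
    - (+ topmost (tab D) (posOf (colLab D) x))

-- surp(D) = (surp_1, …, surp_(m+n-1)), a vector of length m' + n = m + n - 1
surp : {m' n' : ℕ} → LTab (suc m') (suc n') → Vec ℤ (m' + suc n')
surp {m'} {n'} D =
  tabulate {m'} (λ k → surpRow D (suc (toℕ k)))
    ++ tabulate {suc n'} (λ k → surpCol D (toℕ k))

module Submission where

open import Defs
open import Algebra.Bundles using (AbelianGroup)
open import Data.Bool using (Bool; true; false; _∧_; _∨_; if_then_else_; T)
open import Data.Bool.ListAction using (any; all)
open import Data.Bool.Properties using (T-∧; T-∨; ¬-not)
open import Data.Empty using (⊥-elim)
open import Data.Fin as Fin using (Fin; toℕ; fromℕ<; punchOut)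
  renaming (zero to fzero; suc to fsuc)
open import Data.Fin.Properties
  using (toℕ-injective; toℕ-fromℕ<; toℕ<n; punchOut-injective; injective⇒≤; any?)
  renaming (_≟_ to _≟ᶠ_)
open import Data.Integer using (+_; -_; _-_)
open import Data.Integer.Properties using (+-0-abelianGroup; neg-injective; +-injective)
open import Algebra.Properties.Group (AbelianGroup.group +-0-abelianGroup) using (∙-cancelˡ)
open import Data.List as List using (List; []; _∷_; upTo; allFin; filterᵇ; length)
open import Data.List.Membership.Propositional using (_∈_; find; lose)
open import Data.List.Membership.Propositional.Properties
  using (∈-upTo⁺; ∈-upTo⁻; ∈-allFin; ∈-map⁺; ∈-map⁻; ∈-filter⁺; ∈-filter⁻)
open import Data.List.Properties using (length-map; filter-all; filter-none; filter-≐)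
open import Data.List.Relation.Unary.All as All using (All)
open import Data.List.Relation.Unary.All.Properties using (all⁺; all⁻)
open import Data.List.Relation.Unary.AllPairs as AllPairs using (AllPairs)
open import Data.List.Relation.Unary.Any using (here; there)
open import Data.List.Relation.Unary.Any.Properties using (any⁺; any⁻)
open import Data.List.Relation.Unary.Unique.Propositional using (Unique)
import Data.List.Relation.Unary.Unique.Propositional.Properties as Unique
open import Data.Nat
open import Data.Nat.Properties
open import Data.Product using (_×_; _,_; proj₁; proj₂; ∃-syntax)
open import Data.Sum as Sum using (_⊎_; inj₁; inj₂; [_,_]′)
open import Data.Vec using (Vec; []; _∷_; lookup; tabulate; replicate; map)
open import Data.Vec.Properties
  using (lookup∘tabulate; tabulate∘lookup; tabulate-cong; lookup-map; ++-injectiveˡ; ++-injectiveʳ)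
open import Function using (_∘_; Equivalence)
open import Function.Definitions using (Injective; Surjective; Bijective)
open import Relation.Binary.Core using (_Preserves_⟶_)
open import Relation.Binary.Definitions using (tri<; tri≈; tri>)
open import Relation.Binary.PropositionalEquality
open import Relation.Nullary using (yes; no)
open import Relation.Nullary.Decidable using (T?)

open Equivalence using (to; from)

-- The corners of the bounce path of a parallelogram polyomino move weakly down and right and reach the
-- bottom-right cell after at most m steps, so each row of bounce T is one interval [a i , a (i+1)] of
-- columns, consecutive rows overlapping in a single column: a ribbon with m + n - 1 cells. Sorting the
-- labels inside each block keeps a permutation that increases along blocks and leaves v₀ on top.
--
-- Conversely, B D and surp D give for every label the leftmost column of its row in D (row v₀ is the top
-- row, starting in column 0), and likewise for column labels. A labelling that increases along the blocks
-- of a weakly increasing key is determined by the key of each label, because the order of the indices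
-- is the lexicographic order of (key, label). Finally, a parallelogram polyomino is determined by where
-- its rows and columns start: (i , j) is a cell iff it lies right of the first cell of row i and below
-- the first cell of column j.

false≢true : false ≢ true
false≢true ()

≡true-ext : ∀ {b c : Bool} → (b ≡ true → c ≡ true) → (c ≡ true → b ≡ true) → b ≡ c
≡true-ext {false} {false} _ _ = refl
≡true-ext {false} {true}  _ g = g refl
≡true-ext {true}  {false} f _ = sym (f refl)
≡true-ext {true}  {true}  _ _ = refl

<ᵇ-irrefl : ∀ n → (n <ᵇ n) ≡ false
<ᵇ-irrefl zero    = refl
<ᵇ-irrefl (suc n) = <ᵇ-irrefl n

T⇒≡true : ∀ {b} → T b → b ≡ true
T⇒≡true {true} _ = refl

≡true⇒T : ∀ {b} → b ≡ true → T b
≡true⇒T refl = _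

inRange⁻ : ∀ {a x b} → T (inRange a x b) → a ≤ x × x ≤ b
inRange⁻ {a} {x} {b} h =
  let a≤x , x≤b = to T-∧ h in ≤ᵇ⇒≤ a x a≤x , ≤ᵇ⇒≤ x b x≤b

inRange⁺ : ∀ {a x b} → a ≤ x → x ≤ b → T (inRange a x b)
inRange⁺ a≤x x≤b = from T-∧ (≤⇒≤ᵇ a≤x , ≤⇒≤ᵇ x≤b)

vget-lookup : ∀ {A : Set} {k} (d : A) (v : Vec A k) (i : Fin k) → vget d v (toℕ i) ≡ lookup v i
vget-lookup d (x ∷ v) fzero    = refl
vget-lookup d (x ∷ v) (fsuc i) = vget-lookup d v i

vget-tabulate : ∀ {A : Set} {k} (d : A) (g : ℕ → A) {j} → j < k → vget d (tabulate {k} (g ∘ toℕ)) j ≡ g j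
vget-tabulate {k = suc k} d g {zero}  _         = refl
vget-tabulate {k = suc k} d g {suc j} (s≤s j<k) = vget-tabulate {k = k} d (g ∘ suc) j<k

vget-replicate : ∀ {k} j → vget false (replicate k false) j ≡ false
vget-replicate {zero}  j       = refl
vget-replicate {suc k} zero    = refl
vget-replicate {suc k} (suc j) = vget-replicate {k} j

vget-≥length : ∀ {k} (v : Vec Bool k) {j} → k ≤ j → vget false v j ≡ false
vget-≥length []      _               = refl
vget-≥length (x ∷ v) {suc j} (s≤s k≤j) = vget-≥length v k≤j

vget-ext : ∀ {k} (u v : Vec Bool k) → (∀ j → vget false u j ≡ vget false v j) → u ≡ v
vget-ext []      []      _ = refl
vget-ext (a ∷ u) (b ∷ v) h = cong₂ _∷_ (h 0) (vget-ext u v (h ∘ suc))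

firstTrue-≤ : ∀ {k} (v : Vec Bool k) {x} → vget false v x ≡ true → firstTrue v ≤ x
firstTrue-≤ (true ∷ v)  h = z≤n
firstTrue-≤ (false ∷ v) {suc x} h = s≤s (firstTrue-≤ v h)

firstTrue-minimal : ∀ {k} (v : Vec Bool k) {j} → j < firstTrue v → vget false v j ≡ false
firstTrue-minimal (false ∷ v) {zero}  _         = refl
firstTrue-minimal (false ∷ v) {suc j} (s≤s j<) = firstTrue-minimal v j<

vget-firstTrue : ∀ {k} (v : Vec Bool k) {x} → vget false v x ≡ true → vget false v (firstTrue v) ≡ true
vget-firstTrue (true ∷ v)  h = refl
vget-firstTrue (false ∷ v) {suc x} h = vget-firstTrue v h

firstTrue-unique : ∀ {k} (v : Vec Bool k) {x} → vget false v x ≡ true →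
                   (∀ {j} → j < x → vget false v j ≡ false) → firstTrue v ≡ x
firstTrue-unique v {x} h below with <-cmp (firstTrue v) x
... | tri≈ _ e _ = e
... | tri< f<x _ _ = ⊥-elim (false≢true (trans (sym (below f<x)) (vget-firstTrue v h)))
... | tri> _ _ x<f = ⊥-elim (false≢true (trans (sym (firstTrue-minimal v x<f)) h))

vget⇒anyTrue : ∀ {k} (v : Vec Bool k) {x} → vget false v x ≡ true → anyTrue v ≡ true
vget⇒anyTrue (true ∷ v)  {zero}  h = refl
vget⇒anyTrue (true ∷ v)  {suc x} h = refl
vget⇒anyTrue (false ∷ v) {suc x} h = vget⇒anyTrue v h

anyTrue⇒vget : ∀ {k} (v : Vec Bool k) → anyTrue v ≡ true → ∃[ x ] (vget false v x ≡ true)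
anyTrue⇒vget (true ∷ v)  h = 0 , refl
anyTrue⇒vget (false ∷ v) h = let x , e = anyTrue⇒vget v h in suc x , e

lastTrue-≥ : ∀ {k} (v : Vec Bool k) {x} → vget false v x ≡ true → x ≤ lastTrue v
lastTrue-≥ (b ∷ v) {zero}  h = z≤n
lastTrue-≥ (b ∷ v) {suc x} h rewrite vget⇒anyTrue v h = s≤s (lastTrue-≥ v h)

lastTrue-maximal : ∀ {k} (v : Vec Bool k) {j} → lastTrue v < j → vget false v j ≡ false
lastTrue-maximal []      _ = refl
lastTrue-maximal (b ∷ v) {suc j} l<j with anyTrue v in any-v
... | true  = lastTrue-maximal v (≤-pred l<j)
... | false = ¬-not (λ e → false≢true (trans (sym any-v) (vget⇒anyTrue v e)))

vget-lastTrue : ∀ {k} (v : Vec Bool k) {x} → vget false v x ≡ true → vget false v (lastTrue v) ≡ true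
vget-lastTrue (b ∷ v) h with anyTrue v in any-v
... | true = vget-lastTrue v (proj₂ (anyTrue⇒vget v any-v))
vget-lastTrue (b ∷ v) {zero}  h | false = h
vget-lastTrue (b ∷ v) {suc x} h | false = ⊥-elim (false≢true (trans (sym any-v) (vget⇒anyTrue v h)))

lastTrue-< : ∀ {k} (v : Vec Bool (suc k)) → lastTrue v ≤ k
lastTrue-< {zero}  (b ∷ []) = z≤n
lastTrue-< {suc k} (b ∷ v) with anyTrue v
... | true  = s≤s (lastTrue-< v)
... | false = z≤n

lastTrue-unique : ∀ {k} (v : Vec Bool k) {x} → vget false v x ≡ true →
                  (∀ {j} → x < j → vget false v j ≡ false) → lastTrue v ≡ x
lastTrue-unique v {x} h above with <-cmp (lastTrue v) x
... | tri≈ _ e _ = e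
... | tri< l<x _ _ = ⊥-elim (false≢true (trans (sym (lastTrue-maximal v l<x)) h))
... | tri> _ _ x<l = ⊥-elim (false≢true (trans (sym (above x<l)) (vget-lastTrue v h)))

countTrue-none : ∀ {k} (v : Vec Bool k) → (∀ j → vget false v j ≡ false) → countTrue v ≡ 0
countTrue-none []          h = refl
countTrue-none (true ∷ v)  h = ⊥-elim (false≢true (sym (h 0)))
countTrue-none (false ∷ v) h = countTrue-none v (h ∘ suc)

countTrue-interval : ∀ {k} (v : Vec Bool k) {x y} → x ≤ y →
  (∀ j → vget false v j ≡ true → x ≤ j × j ≤ y) →
  (∀ j → x ≤ j → j ≤ y → vget false v j ≡ true) →
  countTrue v ≡ suc (y ∸ x)
countTrue-interval [] {y = y} x≤y inside filled = ⊥-elim (false≢true (filled y x≤y ≤-refl))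
countTrue-interval (true ∷ v) {zero} {zero} _ inside filled =
  cong suc (countTrue-none v (λ j → ¬-not (λ e → <⇒≱ z<s (proj₂ (inside (suc j) e)))))
countTrue-interval (true ∷ v) {zero} {suc y} _ inside filled =
  cong suc (countTrue-interval v z≤n (λ j e → z≤n , ≤-pred (proj₂ (inside (suc j) e)))
                                     (λ j _ j≤y → filled (suc j) z≤n (s≤s j≤y)))
countTrue-interval (true ∷ v) {suc x} _ inside filled = ⊥-elim (<⇒≱ z<s (proj₁ (inside 0 refl)))
countTrue-interval (false ∷ v) {zero} _ inside filled = ⊥-elim (false≢true (filled 0 z≤n z≤n))
countTrue-interval (false ∷ v) {suc x} {suc y} (s≤s x≤y) inside filled =
  countTrue-interval v x≤y (λ j e → let x≤ , ≤y = inside (suc j) e in ≤-pred x≤ , ≤-pred ≤y)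
                           (λ j x≤j j≤y → filled (suc j) (s≤s x≤j) (s≤s j≤y))

vget-col : ∀ {m n} (P : Tab m n) j i → vget false (col P j) i ≡ entry P i j
vget-col {n = n} []      j i       = sym (vget-replicate {n} j)
vget-col         (r ∷ P) j zero    = refl
vget-col         (r ∷ P) j (suc i) = vget-col P j i

entry-≥rows : ∀ {m n} (P : Tab m n) {i} j → m ≤ i → entry P i j ≡ false
entry-≥rows {n = n} []      j _           = vget-replicate {n} j
entry-≥rows         (r ∷ P) {suc i} j (s≤s m≤i) = entry-≥rows P j m≤i

entry-≥cols : ∀ {m n} (P : Tab m n) i {j} → n ≤ j → entry P i j ≡ false
entry-≥cols P i = vget-≥length (row P i)

Tab-ext : ∀ {m n} (P Q : Tab m n) → (∀ i j → entry P i j ≡ entry Q i j) → P ≡ Q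
Tab-ext []      []      _ = refl
Tab-ext (r ∷ P) (s ∷ Q) h = cong₂ _∷_ (vget-ext r s (h 0)) (Tab-ext P Q (h ∘ suc))

MonotoneUpTo : ℕ → (ℕ → ℕ) → Set
MonotoneUpTo M f = ∀ {i i'} → i ≤ i' → i' ≤ M → f i ≤ f i'

stepwise⇒monotoneUpTo : ∀ {M} (f : ℕ → ℕ) → (∀ k → k < M → f k ≤ f (suc k)) → MonotoneUpTo M f
stepwise⇒monotoneUpTo f step {i' = zero}  z≤n _ = ≤-refl
stepwise⇒monotoneUpTo f step {i} {suc i'} i≤ i'<M with m≤n⇒m<n∨m≡n i≤
... | inj₂ refl = ≤-refl
... | inj₁ i<   = ≤-trans (stepwise⇒monotoneUpTo f step (≤-pred i<) (<⇒≤ i'<M)) (step i' i'<M)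

stepwise⇒monotone : (f : ℕ → ℕ) → (∀ k → f k ≤ f (suc k)) → ∀ {k k'} → k ≤ k' → f k ≤ f k'
stepwise⇒monotone f step k≤k' = stepwise⇒monotoneUpTo f (λ k _ → step k) k≤k' ≤-refl

∸-telescope : ∀ {x y z} → x ≤ y → y ≤ z → (y ∸ x) + (z ∸ y) ≡ z ∸ x
∸-telescope {x} {y} {z} x≤y y≤z = +-cancelˡ-≡ x _ _ (begin
  x + ((y ∸ x) + (z ∸ y)) ≡⟨ +-assoc x _ _ ⟨
  (x + (y ∸ x)) + (z ∸ y) ≡⟨ cong (_+ (z ∸ y)) (m+[n∸m]≡n x≤y) ⟩
  y + (z ∸ y)             ≡⟨ m+[n∸m]≡n y≤z ⟩
  z                       ≡⟨ m+[n∸m]≡n (≤-trans x≤y y≤z) ⟨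
  x + (z ∸ x)             ∎)
  where open ≡-Reasoning

ones-intervalRows : ∀ {m n} (P : Tab m n) (a : ℕ → ℕ) → (∀ i → a i ≤ a (suc i)) →
  (∀ i → i < m → countTrue (row P i) ≡ suc (a (suc i) ∸ a i)) →
  ones P ≡ m + (a m ∸ a 0)
ones-intervalRows []      a a-step rows = sym (n∸n≡0 (a 0))
ones-intervalRows {suc m} (r ∷ P) a a-step rows = begin
  countTrue r + ones P
    ≡⟨ cong₂ _+_ (rows 0 z<s)
                 (ones-intervalRows P (a ∘ suc) (a-step ∘ suc) (λ i i<m → rows (suc i) (s≤s i<m))) ⟩
  suc (a 1 ∸ a 0) + (m + (a (suc m) ∸ a 1))
    ≡⟨ cong suc (+-assoc (a 1 ∸ a 0) m _) ⟨
  suc ((a 1 ∸ a 0) + m + (a (suc m) ∸ a 1))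
    ≡⟨ cong (λ z → suc (z + (a (suc m) ∸ a 1))) (+-comm (a 1 ∸ a 0) m) ⟩
  suc (m + (a 1 ∸ a 0) + (a (suc m) ∸ a 1))
    ≡⟨ cong suc (+-assoc m _ _) ⟩
  suc (m + ((a 1 ∸ a 0) + (a (suc m) ∸ a 1)))
    ≡⟨ cong (λ z → suc (m + z)) (∸-telescope (a-step 0) (stepwise⇒monotone a a-step (s≤s z≤n))) ⟩
  suc (m + (a (suc m) ∸ a 0)) ∎
  where open ≡-Reasoning

module Parallelogram {m' n' : ℕ} {P : Tab (suc m') (suc n')} (isP : IsParallelogram P) where
  open IsParallelogram isP

  entry⇒row≤ : ∀ {i j} → entry P i j ≡ true → i ≤ m'
  entry⇒row≤ {i} {j} e with m' <? i
  ... | yes m'<i = ⊥-elim (false≢true (trans (sym (entry-≥rows P j m'<i)) e))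
  ... | no  m'≮i = ≮⇒≥ m'≮i

  entry⇒col≤ : ∀ {i j} → entry P i j ≡ true → j ≤ n'
  entry⇒col≤ {i} {j} e with n' <? j
  ... | yes n'<j = ⊥-elim (false≢true (trans (sym (entry-≥cols P i n'<j)) e))
  ... | no  n'≮j = ≮⇒≥ n'≮j

  entry⇒leftmost≤ : ∀ {i j} → entry P i j ≡ true → leftmost P i ≤ j
  entry⇒leftmost≤ {i} = firstTrue-≤ (row P i)

  entry⇒≤rightmost : ∀ {i j} → entry P i j ≡ true → j ≤ rightmost P i
  entry⇒≤rightmost {i} = lastTrue-≥ (row P i)

  entry⇒topmost≤ : ∀ {i j} → entry P i j ≡ true → topmost P j ≤ i
  entry⇒topmost≤ {i} {j} e = firstTrue-≤ (col P j) (trans (vget-col P j i) e)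

  entry⇒≤lowest : ∀ {i j} → entry P i j ≡ true → i ≤ lowest P j
  entry⇒≤lowest {i} {j} e = lastTrue-≥ (col P j) (trans (vget-col P j i) e)

  entry-rightmost : ∀ {i} → i ≤ m' → entry P i (rightmost P i) ≡ true
  entry-rightmost {i} i≤m' =
    let _ , _ , e = row-nonempty i (s≤s i≤m') in vget-lastTrue (row P i) e

  entry-lowest : ∀ {i j} → entry P i j ≡ true → entry P (lowest P j) j ≡ true
  entry-lowest {i} {j} e =
    trans (sym (vget-col P j _)) (vget-lastTrue (col P j) (trans (vget-col P j i) e))

  within⇒entry : ∀ {i j} → i ≤ m' → leftmost P i ≤ j → j ≤ rightmost P i → entry P i j ≡ true
  within⇒entry {i} {j} i≤m' = row-contiguous i (s≤s i≤m') j

  leftmost-mono : MonotoneUpTo m' (leftmost P)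
  leftmost-mono = stepwise⇒monotoneUpTo (leftmost P) (λ k k<m' → left-mono k (s≤s k<m'))

  rightmost-mono : MonotoneUpTo m' (rightmost P)
  rightmost-mono = stepwise⇒monotoneUpTo (rightmost P) (λ k k<m' → right-mono k (s≤s k<m'))

  leftmost-top : leftmost P 0 ≡ 0
  leftmost-top = n≤0⇒n≡0 (entry⇒leftmost≤ corner-top)

  rightmost-bottom : rightmost P m' ≡ n'
  rightmost-bottom = ≤-antisym (lastTrue-< (row P m')) (entry⇒≤rightmost corner-bottom)

  lowest-last : lowest P n' ≡ m'
  lowest-last = ≤-antisym (lastTrue-< (col P n')) (entry⇒≤lowest corner-bottom)

  -- Walk up from row i while the row starts right of column j; left-bound keeps j within reach.
  cell-above : ∀ {j} i → i ≤ m' → j ≤ rightmost P i → ∃[ i' ] (i' ≤ i × entry P i' j ≡ true)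
  cell-above {j} zero _ j≤r = 0 , z≤n , within⇒entry z≤n (subst (_≤ j) (sym leftmost-top) z≤n) j≤r
  cell-above {j} (suc i) i<m' j≤r with leftmost P (suc i) ≤? j
  ... | yes l≤j = suc i , ≤-refl , within⇒entry i<m' l≤j j≤r
  ... | no  l≰j =
    let i' , i'≤i , e = cell-above i (<⇒≤ i<m') (≤-trans (<⇒≤ (≰⇒> l≰j)) (left-bound i (s≤s i<m')))
    in i' , m≤n⇒m≤1+n i'≤i , e

  entry-topmost : ∀ {j} → j ≤ n' → entry P (topmost P j) j ≡ true
  entry-topmost {j} j≤n' =
    let i , _ , e = cell-above m' ≤-refl (subst (j ≤_) (sym rightmost-bottom) j≤n')
    in trans (sym (vget-col P j _)) (vget-firstTrue (col P j) (trans (vget-col P j i) e))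

  topmost-mono : MonotoneUpTo n' (topmost P)
  topmost-mono = stepwise⇒monotoneUpTo (topmost P) step
    where
      step : ∀ j → j < n' → topmost P j ≤ topmost P (suc j)
      step j j<n' =
        let e = entry-topmost j<n'
            i , i≤t , e' = cell-above (topmost P (suc j)) (entry⇒row≤ e)
                                      (≤-trans (n≤1+n j) (entry⇒≤rightmost e))
        in ≤-trans (entry⇒topmost≤ e') i≤t

  leftmost-topmost⇒entry : ∀ {i j} → i ≤ m' → j ≤ n' → leftmost P i ≤ j → topmost P j ≤ i →
                           entry P i j ≡ true
  leftmost-topmost⇒entry i≤m' j≤n' l≤j t≤i = within⇒entry i≤m' l≤j
    (≤-trans (entry⇒≤rightmost (entry-topmost j≤n')) (rightmost-mono t≤i i≤m'))

  corner-row corner-col : ℕ → ℕ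
  corner-row k = proj₁ (bcorner P k)
  corner-col k = proj₂ (bcorner P k)

  entry-corner : ∀ k → entry P (corner-row k) (corner-col k) ≡ true
  entry-corner zero    = corner-top
  entry-corner (suc k) = entry-lowest (entry-rightmost (entry⇒row≤ (entry-corner k)))

  corner-row≤ : ∀ k → corner-row k ≤ m'
  corner-row≤ k = entry⇒row≤ (entry-corner k)

  corner-row-step : ∀ k → corner-row k ≤ corner-row (suc k)
  corner-row-step k = entry⇒≤lowest (entry-rightmost (corner-row≤ k))

  corner-col-step : ∀ k → corner-col k ≤ corner-col (suc k)
  corner-col-step k = entry⇒≤rightmost (entry-corner k)

  corner-row-progress : ∀ k → corner-row k < m' → corner-row k < corner-row (suc k)
  corner-row-progress k r<m' = entry⇒≤lowest
    (within⇒entry r<m' (left-bound (corner-row k) (s≤s r<m')) (right-mono (corner-row k) (s≤s r<m')))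

  corner-row-≥ : ∀ k → k ≤ m' → k ≤ corner-row k
  corner-row-≥ zero    _      = z≤n
  corner-row-≥ (suc k) k<m' with corner-row k <? m'
  ... | yes r<m' = ≤-trans (s≤s (corner-row-≥ k (<⇒≤ k<m'))) (corner-row-progress k r<m')
  ... | no  r≮m' = ≤-trans k<m' (≤-trans (≮⇒≥ r≮m') (corner-row-step k))

  corner-row-last : corner-row m' ≡ m'
  corner-row-last = ≤-antisym (corner-row≤ m') (corner-row-≥ m' ≤-refl)

  bstep-end : bstep P (m' , n') ≡ (m' , n')
  bstep-end = cong₂ _,_ (trans (cong (lowest P) rightmost-bottom) lowest-last) rightmost-bottom

  -- bstep only reads the row of a corner.
  bcorner-end : bcorner P (suc m') ≡ (m' , n')
  bcorner-end = trans (cong (λ r → bstep P (r , n')) corner-row-last) bstep-end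

  bcorner-stable : ∀ {k} → suc m' ≤ k → bcorner P k ≡ (m' , n')
  bcorner-stable {suc k} (s≤s m'≤k) with m≤n⇒m<n∨m≡n m'≤k
  ... | inj₂ refl = bcorner-end
  ... | inj₁ m'<k = trans (cong (bstep P) (bcorner-stable m'<k)) bstep-end

-- The path through the corners (r k , c k), going right along row r k and then down column c (suc k).
module Staircase (r c : ℕ → ℕ) (N M : ℕ)
  (r-zero : r 0 ≡ 0) (c-zero : c 0 ≡ 0)
  (r-step : ∀ k → r k ≤ r (suc k)) (c-step : ∀ k → c k ≤ c (suc k))
  (r≤M : ∀ k → r k ≤ M) (r-end : r N ≡ M) (0<N : 0 < N) where

  segment : ℕ → ℕ → ℕ → Bool
  segment i j k = ((i ≡ᵇ r k) ∧ inRange (c k) j (c (suc k)))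
                ∨ ((j ≡ᵇ c (suc k)) ∧ inRange (r k) i (r (suc k)))

  onPath : ℕ → ℕ → Bool
  onPath i j = any (segment i j) (upTo N)

  search : ℕ → ℕ → ℕ → ℕ
  search i k zero = k
  search i k (suc f) with i ≤? r k
  ... | yes _ = k
  ... | no  _ = search i (suc k) f

  search-bounds : ∀ i k f → k ≤ search i k f × search i k f ≤ k + f
  search-bounds i k zero = ≤-refl , m≤m+n k 0
  search-bounds i k (suc f) with i ≤? r k
  ... | yes _ = ≤-refl , m≤m+n k (suc f)
  ... | no  _ = let k< , ≤k+f = search-bounds i (suc k) f
                in <⇒≤ k< , ≤-trans ≤k+f (≤-reflexive (sym (+-suc k f)))

  search-below : ∀ i k f {k'} → k ≤ k' → k' < search i k f → r k' < i
  search-below i k zero k≤k' k'< = ⊥-elim (<⇒≱ k'< k≤k')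
  search-below i k (suc f) {k'} k≤k' k'< with i ≤? r k
  ... | yes _ = ⊥-elim (<⇒≱ k'< k≤k')
  ... | no  i≰rk with m≤n⇒m<n∨m≡n k≤k'
  ...   | inj₁ k<k' = search-below i (suc k) f k<k' k'<
  ...   | inj₂ refl = ≰⇒> i≰rk

  search-reaches : ∀ i k f → search i k f < k + f → i ≤ r (search i k f)
  search-reaches i k zero s< = ⊥-elim (<-irrefl (sym (+-identityʳ k)) s<)
  search-reaches i k (suc f) s< with i ≤? r k
  ... | yes i≤rk = i≤rk
  ... | no  _    = search-reaches i (suc k) f (<-≤-trans s< (≤-reflexive (+-suc k f)))

  search-least : ∀ i k f {k'} → k ≤ k' → k' ≤ k + f → i ≤ r k' → search i k f ≤ k'
  search-least i k zero    k≤k' _ _ = k≤k'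
  search-least i k (suc f) k≤k' k'≤ i≤ with i ≤? r k
  ... | yes _ = k≤k'
  ... | no  i≰rk with m≤n⇒m<n∨m≡n k≤k'
  ...   | inj₁ k<k' = search-least i (suc k) f k<k' (≤-trans k'≤ (≤-reflexive (+-suc k f))) i≤
  ...   | inj₂ refl = ⊥-elim (i≰rk i≤)

  r-mono : ∀ {k k'} → k ≤ k' → r k ≤ r k'
  r-mono = stepwise⇒monotone r r-step

  c-mono : ∀ {k k'} → k ≤ k' → c k ≤ c k'
  c-mono = stepwise⇒monotone c c-step

  -- reach i is the first corner at or below row i; row i of the path starts in its column.
  reach : ℕ → ℕ
  reach i = search i 0 N

  start : ℕ → ℕ
  start i = c (reach i)

  reach≤N : ∀ i → reach i ≤ N
  reach≤N i = proj₂ (search-bounds i 0 N)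

  reach-below : ∀ {i k} → k < reach i → r k < i
  reach-below = search-below _ 0 N z≤n

  reach-least : ∀ {i k} → k ≤ N → i ≤ r k → reach i ≤ k
  reach-least = search-least _ 0 N z≤n

  reach-reaches : ∀ {i} → i ≤ M → i ≤ r (reach i)
  reach-reaches {i} i≤M with m≤n⇒m<n∨m≡n (reach≤N i)
  ... | inj₁ reach<N = search-reaches i 0 N reach<N
  ... | inj₂ reach≡N = subst (λ k → i ≤ r k) (sym reach≡N) (subst (i ≤_) (sym r-end) i≤M)

  reach-above : ∀ {i k} → r k < i → k < N → k < reach i
  reach-above {i} {k} rk<i k<N with k <? reach i
  ... | yes k<reach = k<reach
  ... | no  k≮reach = ⊥-elim (<⇒≱ rk<i (≤-trans
          (search-reaches i 0 N (≤-<-trans (≮⇒≥ k≮reach) k<N)) (r-mono (≮⇒≥ k≮reach))))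

  reach-beyond : reach (suc M) ≡ N
  reach-beyond with m≤n⇒m<n∨m≡n (reach≤N (suc M))
  ... | inj₁ reach<N = ⊥-elim (<⇒≱ (s≤s (r≤M _)) (search-reaches (suc M) 0 N reach<N))
  ... | inj₂ reach≡N = reach≡N

  reach-step : ∀ i → reach i ≤ reach (suc i)
  reach-step i with reach i in eq
  ... | zero  = z≤n
  ... | suc k = reach-above (≤-trans (reach-below (≤-reflexive (sym eq))) (n≤1+n i))
                            (≤-trans (≤-reflexive (sym eq)) (reach≤N i))

  start-zero : start 0 ≡ 0
  start-zero = trans (cong c (n≤0⇒n≡0 (reach-least z≤n z≤n))) c-zero

  start-step : ∀ i → start i ≤ start (suc i)
  start-step i = c-mono (reach-step i)

  start-beyond : start (suc M) ≡ c N
  start-beyond = cong c reach-beyond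

  crossing : ∀ {j p q} → p < q → c p ≤ j → j ≤ c q →
             ∃[ k ] (p ≤ k × k < q × c k ≤ j × j ≤ c (suc k))
  crossing {j} {p} {suc q} p<q cp≤j j≤cq with m≤n⇒m<n∨m≡n (≤-pred p<q)
  ... | inj₂ refl = p , ≤-refl , ≤-refl , cp≤j , j≤cq
  ... | inj₁ p<q' with j ≤? c q
  ...   | yes j≤ = let k , p≤k , k<q , ck≤j , j≤ck' = crossing p<q' cp≤j j≤
                   in k , p≤k , m<n⇒m<1+n k<q , ck≤j , j≤ck'
  ...   | no  j≰ = q , <⇒≤ p<q' , ≤-refl , <⇒≤ (≰⇒> j≰) , j≤cq

  OnSegment : ℕ → ℕ → ℕ → Set
  OnSegment i j k = (i ≡ r k × c k ≤ j × j ≤ c (suc k)) ⊎ (j ≡ c (suc k) × r k ≤ i × i ≤ r (suc k))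

  onPath⁻ : ∀ {i j} → T (onPath i j) → ∃[ k ] (k < N × OnSegment i j k)
  onPath⁻ {i} {j} h with find (any⁻ (segment i j) (upTo N) h)
  ... | k , k∈ , on-k = k , ∈-upTo⁻ k∈ , [ horizontal , vertical ]′ (to T-∨ on-k)
    where
      horizontal = λ h → let i≡ , inR = to T-∧ h in inj₁ (≡ᵇ⇒≡ i (r k) i≡ , inRange⁻ inR)
      vertical   = λ v → let j≡ , inR = to T-∧ v in inj₂ (≡ᵇ⇒≡ j (c (suc k)) j≡ , inRange⁻ inR)

  onPath⁺ : ∀ {i j k} → k < N → OnSegment i j k → T (onPath i j)
  onPath⁺ {i} {j} {k} k<N on-k =
    any⁺ (segment i j) (lose (∈-upTo⁺ k<N) (from T-∨ (Sum.map horizontal vertical on-k)))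
    where
      horizontal = λ { (i≡ , ck≤j , j≤ck') → from T-∧ (≡⇒≡ᵇ i (r k) i≡ , inRange⁺ ck≤j j≤ck') }
      vertical   = λ { (j≡ , rk≤i , i≤rk') → from T-∧ (≡⇒≡ᵇ j (c (suc k)) j≡ , inRange⁺ rk≤i i≤rk') }

  onSegment⇒interval : ∀ {i j k} → k < N → OnSegment i j k → start i ≤ j × j ≤ start (suc i)
  onSegment⇒interval {i} {j} {k} k<N (inj₁ (i≡rk , ck≤j , j≤ck')) =
    ≤-trans (c-mono (reach-least (<⇒≤ k<N) (≤-reflexive i≡rk))) ck≤j ,
    ≤-trans j≤ck' (c-mono (reach-above (s≤s (≤-reflexive (sym i≡rk))) k<N))
  onSegment⇒interval {i} {j} {k} k<N (inj₂ (j≡ck' , rk≤i , i≤rk')) =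
    ≤-trans (c-mono (reach-least k<N i≤rk')) (≤-reflexive (sym j≡ck')) ,
    ≤-trans (≤-reflexive j≡ck') (c-mono (reach-above (s≤s rk≤i) k<N))

  onPath⇒interval : ∀ {i j} → T (onPath i j) → start i ≤ j × j ≤ start (suc i)
  onPath⇒interval h = let k , k<N , on-k = onPath⁻ h in onSegment⇒interval k<N on-k

  reach-suc-positive : ∀ {i} → i ≤ M → 0 < reach (suc i)
  reach-suc-positive {i} i≤M with suc i ≤? M | reach (suc i) in eq
  ... | _         | suc _ = z<s
  ... | yes i<M   | zero  =
    ⊥-elim (<⇒≱ z<s (≤-trans (subst (λ k → suc i ≤ r k) eq (reach-reaches i<M)) (≤-reflexive r-zero)))
  ... | no  i≮M   | zero  = ⊥-elim (<-irrefl (trans (sym eq) (trans (cong (reach ∘ suc) i≡M) reach-beyond)) 0<N)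
    where
      i≡M : i ≡ M
      i≡M = ≤-antisym i≤M (≤-pred (≰⇒> i≮M))

  -- Row i is covered by the horizontal segments of the corners strictly between reach i and reach (suc i),
  -- or, when there are none, by the vertical segment entering corner reach i.
  interval⇒onPath : ∀ {i j} → i ≤ M → start i ≤ j → j ≤ start (suc i) → T (onPath i j)
  interval⇒onPath {i} {j} i≤M si≤j j≤si' with m≤n⇒m<n∨m≡n (reach-step i)
  ... | inj₁ reach< =
    let k , reach≤k , k<reach' , ck≤j , j≤ck' = crossing reach< si≤j j≤si'
        i≡rk = ≤-antisym (≤-trans (reach-reaches i≤M) (r-mono reach≤k)) (≤-pred (reach-below k<reach'))
    in onPath⁺ (<-≤-trans k<reach' (reach≤N (suc i))) (inj₁ (i≡rk , ck≤j , j≤ck'))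
  ... | inj₂ reach≡ with reach i in eq
  ...   | zero  = ⊥-elim (<-irrefl reach≡ (reach-suc-positive i≤M))
  ...   | suc k =
    let k<reach = ≤-reflexive (sym eq) in
    onPath⁺ (≤-trans k<reach (reach≤N i)) (inj₂
      ( ≤-antisym (subst (λ z → j ≤ c z) (sym reach≡) j≤si') si≤j
      , <⇒≤ (reach-below k<reach)
      , subst (λ z → i ≤ r z) eq (reach-reaches i≤M)))

module IntervalRows {m' n' : ℕ} (P : Tab (suc m') (suc n')) (a : ℕ → ℕ)
  (a-zero : a 0 ≡ 0) (a-step : ∀ i → a i ≤ a (suc i)) (a-end : a (suc m') ≡ n')
  (entry⇒interval : ∀ {i j} → i ≤ m' → entry P i j ≡ true → a i ≤ j × j ≤ a (suc i))
  (interval⇒entry : ∀ {i j} → i ≤ m' → a i ≤ j → j ≤ a (suc i) → entry P i j ≡ true) where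

  leftmost≡ : ∀ {i} → i ≤ m' → leftmost P i ≡ a i
  leftmost≡ {i} i≤m' = firstTrue-unique (row P i) (interval⇒entry i≤m' ≤-refl (a-step i))
    (λ j<a → ¬-not (λ e → <⇒≱ j<a (proj₁ (entry⇒interval i≤m' e))))

  rightmost≡ : ∀ {i} → i ≤ m' → rightmost P i ≡ a (suc i)
  rightmost≡ {i} i≤m' = lastTrue-unique (row P i) (interval⇒entry i≤m' (a-step i) ≤-refl)
    (λ a<j → ¬-not (λ e → <⇒≱ a<j (proj₂ (entry⇒interval i≤m' e))))

  isParallelogram : IsParallelogram P
  isParallelogram = record
    { corner-top     = interval⇒entry z≤n (≤-reflexive a-zero) z≤n
    ; corner-bottom  = interval⇒entry ≤-refl (subst (a m' ≤_) a-end (a-step m')) (≤-reflexive (sym a-end))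
    ; row-nonempty   = λ i i<m → a i , s≤s (a≤n' (≤-pred i<m)) , interval⇒entry (≤-pred i<m) ≤-refl (a-step i)
    ; row-contiguous = λ i i<m j l≤j j≤r → interval⇒entry (≤-pred i<m)
                         (subst (_≤ j) (leftmost≡ (≤-pred i<m)) l≤j) (subst (j ≤_) (rightmost≡ (≤-pred i<m)) j≤r)
    ; left-mono      = λ i i<m → subst₂ _≤_ (sym (leftmost≡ (prev i<m))) (sym (leftmost≡ (≤-pred i<m))) (a-step i)
    ; left-bound     = λ i i<m → ≤-reflexive (trans (leftmost≡ (≤-pred i<m)) (sym (rightmost≡ (prev i<m))))
    ; right-mono     = λ i i<m → subst₂ _≤_ (sym (rightmost≡ (prev i<m))) (sym (rightmost≡ (≤-pred i<m)))
                                            (a-step (suc i))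
    }
    where
      prev : ∀ {i} → suc i < suc m' → i ≤ m'
      prev i<m = ≤-pred (<⇒≤ i<m)

      a≤n' : ∀ {i} → i ≤ m' → a i ≤ n'
      a≤n' i≤m' = subst (_ ≤_) a-end (stepwise⇒monotone a a-step (m≤n⇒m≤1+n i≤m'))

  ones≡ : ones P ≡ suc m' + suc n' ∸ 1
  ones≡ = begin
    ones P                      ≡⟨ ones-intervalRows P a a-step (λ i i<m →
                                     countTrue-interval (row P i) (a-step i)
                                       (λ j → entry⇒interval (≤-pred i<m))
                                       (λ j → interval⇒entry (≤-pred i<m))) ⟩
    suc m' + (a (suc m') ∸ a 0) ≡⟨ cong₂ (λ x y → suc m' + (x ∸ y)) a-end a-zero ⟩
    suc m' + n'                 ≡⟨ +-suc m' n' ⟨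
    suc m' + suc n' ∸ 1         ∎
    where open ≡-Reasoning

entry-bounce : ∀ {m n} (T : Tab m n) {i j} → i < m → j < n →
               entry (bounce T) i j ≡ any (onSeg T i j) (upTo (m + n))
entry-bounce {m} {n} T {i} {j} i<m j<n =
  trans (cong (λ v → vget false v j) (vget-tabulate (replicate n false) (λ i' → tabulate (cell i' ∘ toℕ)) i<m))
        (vget-tabulate false (cell i) j<n)
  where
    cell : ℕ → ℕ → Bool
    cell i' j' = any (onSeg T i' j') (upTo (m + n))

module Bounce {m' n' : ℕ} {T : Tab (suc m') (suc n')} (isP : IsParallelogram T) where
  open Parallelogram isP
  open Staircase corner-row corner-col (suc m' + suc n') m' refl refl corner-row-step corner-col-step
                 corner-row≤ (cong proj₁ (bcorner-stable (m≤m+n (suc m') (suc n')))) z<s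

  private
    bounce⇒interval : ∀ {i j} → i ≤ m' → entry (bounce T) i j ≡ true → start i ≤ j × j ≤ start (suc i)
    bounce⇒interval {i} {j} i≤m' e with j ≤? n'
    ... | yes j≤n' = onPath⇒interval (≡true⇒T (trans (sym (entry-bounce T (s≤s i≤m') (s≤s j≤n'))) e))
    ... | no  j≰n' = ⊥-elim (false≢true (trans (sym (entry-≥cols (bounce T) i (≰⇒> j≰n'))) e))

    start-end : start (suc m') ≡ n'
    start-end = trans start-beyond (cong proj₂ (bcorner-stable (m≤m+n (suc m') (suc n'))))

    interval⇒bounce : ∀ {i j} → i ≤ m' → start i ≤ j → j ≤ start (suc i) → entry (bounce T) i j ≡ true
    interval⇒bounce {i} {j} i≤m' si≤j j≤si' =
      trans (entry-bounce T (s≤s i≤m') (s≤s j≤n')) (T⇒≡true (interval⇒onPath i≤m' si≤j j≤si'))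
      where
        j≤n' : j ≤ n'
        j≤n' = ≤-trans j≤si' (subst (start (suc i) ≤_) start-end (stepwise⇒monotone start start-step (s≤s i≤m')))

  open IntervalRows (bounce T) start start-zero start-step start-end bounce⇒interval interval⇒bounce public

module _ {A : Set} where

  length-filterᵇ-≤ : (p q : A → Bool) (xs : List A) → (∀ {x} → x ∈ xs → T (p x) → T (q x)) →
                     length (filterᵇ p xs) ≤ length (filterᵇ q xs)
  length-filterᵇ-≤ p q [] p⊆q = z≤n
  length-filterᵇ-≤ p q (y ∷ xs) p⊆q with p y in py | q y in qy
  ... | true  | true  = s≤s (length-filterᵇ-≤ p q xs (p⊆q ∘ there))
  ... | true  | false = ⊥-elim (subst T qy (p⊆q (here refl) (subst T (sym py) _)))
  ... | false | true  = m≤n⇒m≤1+n (length-filterᵇ-≤ p q xs (p⊆q ∘ there))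
  ... | false | false = length-filterᵇ-≤ p q xs (p⊆q ∘ there)

  length-filterᵇ-< : (p q : A → Bool) (xs : List A) → (∀ {x} → x ∈ xs → T (p x) → T (q x)) →
                     ∀ {z} → z ∈ xs → p z ≡ false → q z ≡ true →
                     length (filterᵇ p xs) < length (filterᵇ q xs)
  length-filterᵇ-< p q (y ∷ xs) p⊆q (here refl) pz qz rewrite pz | qz =
    s≤s (length-filterᵇ-≤ p q xs (p⊆q ∘ there))
  length-filterᵇ-< p q (y ∷ xs) p⊆q (there z∈) pz qz with p y in py | q y in qy
  ... | true  | true  = s≤s (length-filterᵇ-< p q xs (p⊆q ∘ there) z∈ pz qz)
  ... | true  | false = ⊥-elim (subst T qy (p⊆q (here refl) (subst T (sym py) _)))
  ... | false | true  = m≤n⇒m≤1+n (length-filterᵇ-< p q xs (p⊆q ∘ there) z∈ pz qz)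
  ... | false | false = length-filterᵇ-< p q xs (p⊆q ∘ there) z∈ pz qz

  nth-∈ : (d : A) (ys : List A) {p : ℕ} → p < length ys → nth d ys p ∈ ys
  nth-∈ d (y ∷ ys) {zero}  _         = here refl
  nth-∈ d (y ∷ ys) {suc p} (s≤s p<) = there (nth-∈ d ys p<)

module _ {K : ℕ} where

  Sorted : List (Fin K) → Set
  Sorted = AllPairs Fin._<_

  ∈-insertF⁻ : ∀ (x : Fin K) ys {y} → y ∈ insertF x ys → y ≡ x ⊎ y ∈ ys
  ∈-insertF⁻ x [] (here refl) = inj₁ refl
  ∈-insertF⁻ x (z ∷ ys) y∈ with toℕ x ≤ᵇ toℕ z
  ∈-insertF⁻ x (z ∷ ys) (here refl) | true  = inj₁ refl
  ∈-insertF⁻ x (z ∷ ys) (there y∈)  | true  = inj₂ y∈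
  ∈-insertF⁻ x (z ∷ ys) (here refl) | false = inj₂ (here refl)
  ∈-insertF⁻ x (z ∷ ys) (there y∈)  | false = [ inj₁ , inj₂ ∘ there ]′ (∈-insertF⁻ x ys y∈)

  ∈-insertF⁺ˡ : ∀ (x : Fin K) ys → x ∈ insertF x ys
  ∈-insertF⁺ˡ x [] = here refl
  ∈-insertF⁺ˡ x (z ∷ ys) with toℕ x ≤ᵇ toℕ z
  ... | true  = here refl
  ... | false = there (∈-insertF⁺ˡ x ys)

  ∈-insertF⁺ʳ : ∀ (x : Fin K) ys {y} → y ∈ ys → y ∈ insertF x ys
  ∈-insertF⁺ʳ x (z ∷ ys) y∈ with toℕ x ≤ᵇ toℕ z
  ∈-insertF⁺ʳ x (z ∷ ys) y∈          | true  = there y∈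
  ∈-insertF⁺ʳ x (z ∷ ys) (here refl) | false = here refl
  ∈-insertF⁺ʳ x (z ∷ ys) (there y∈)  | false = there (∈-insertF⁺ʳ x ys y∈)

  ∈-sortF⁻ : ∀ (xs : List (Fin K)) {y} → y ∈ sortF xs → y ∈ xs
  ∈-sortF⁻ (x ∷ xs) y∈ =
    [ (λ { refl → here refl }) , there ∘ ∈-sortF⁻ xs ]′ (∈-insertF⁻ x (sortF xs) y∈)

  ∈-sortF⁺ : ∀ (xs : List (Fin K)) {y} → y ∈ xs → y ∈ sortF xs
  ∈-sortF⁺ (x ∷ xs) (here refl) = ∈-insertF⁺ˡ x (sortF xs)
  ∈-sortF⁺ (x ∷ xs) (there y∈)  = ∈-insertF⁺ʳ x (sortF xs) (∈-sortF⁺ xs y∈)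

  length-insertF : ∀ (x : Fin K) ys → length (insertF x ys) ≡ suc (length ys)
  length-insertF x [] = refl
  length-insertF x (z ∷ ys) with toℕ x ≤ᵇ toℕ z
  ... | true  = refl
  ... | false = cong suc (length-insertF x ys)

  length-sortF : ∀ (xs : List (Fin K)) → length (sortF xs) ≡ length xs
  length-sortF []       = refl
  length-sortF (x ∷ xs) = trans (length-insertF x (sortF xs)) (cong suc (length-sortF xs))

  insertF-sorted : ∀ (x : Fin K) ys → Sorted ys → All (x ≢_) ys → Sorted (insertF x ys)
  insertF-sorted x [] _ _ = All.[] AllPairs.∷ AllPairs.[]
  insertF-sorted x (z ∷ ys) (z<ys AllPairs.∷ sorted) (x≢z All.∷ x∉ys) with toℕ x ≤ᵇ toℕ z in x≤z
  ... | true  = (x<z All.∷ All.map (<-trans x<z) z<ys) AllPairs.∷ z<ys AllPairs.∷ sorted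
    where
      x<z : x Fin.< z
      x<z = ≤∧≢⇒< (≤ᵇ⇒≤ _ _ (≡true⇒T x≤z)) (x≢z ∘ toℕ-injective)
  ... | false = All.tabulate z<insert AllPairs.∷ insertF-sorted x ys sorted x∉ys
    where
      z<x : z Fin.< x
      z<x = ≰⇒> (λ x≤z' → false≢true (trans (sym x≤z) (T⇒≡true (≤⇒≤ᵇ x≤z'))))
      z<insert : ∀ {w} → w ∈ insertF x ys → z Fin.< w
      z<insert w∈ = [ (λ { refl → z<x }) , All.lookup z<ys ]′ (∈-insertF⁻ x ys w∈)

  sortF-sorted : ∀ (xs : List (Fin K)) → Unique xs → Sorted (sortF xs)
  sortF-sorted []       _ = AllPairs.[]
  sortF-sorted (x ∷ xs) (x∉xs AllPairs.∷ unique) =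
    insertF-sorted x (sortF xs) (sortF-sorted xs unique) (All.tabulate (All.lookup x∉xs ∘ ∈-sortF⁻ xs))

  nth-strictMono : ∀ (d : Fin K) ys → Sorted ys → ∀ {p q} → p < q → q < length ys → nth d ys p Fin.< nth d ys q
  nth-strictMono d (y ∷ ys) (y<ys AllPairs.∷ _) {zero} {suc q} _ (s≤s q<) = All.lookup y<ys (nth-∈ d ys q<)
  nth-strictMono d (y ∷ ys) (_ AllPairs.∷ sorted) {suc p} {suc q} (s≤s p<q) (s≤s q<) =
    nth-strictMono d ys sorted p<q q<

  nth-zero-≤ : ∀ (d : Fin K) ys → Sorted ys → ∀ {y} → y ∈ ys → toℕ (nth d ys 0) ≤ toℕ y
  nth-zero-≤ d (y ∷ ys) _                    (here refl) = ≤-refl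
  nth-zero-≤ d (y ∷ ys) (y<ys AllPairs.∷ _) (there y∈)  = <⇒≤ (All.lookup y<ys y∈)

injective⇒surjective : ∀ {n} (f : Fin n → Fin n) → Injective _≡_ _≡_ f → Surjective _≡_ _≡_ f
injective⇒surjective f f-inj y with any? (λ x → f x ≟ᶠ y)
... | yes (x , fx≡y) = x , λ { refl → fx≡y }
injective⇒surjective {suc n} f f-inj y | no y∉im =
  ⊥-elim (1+n≰n (injective⇒≤ {f = squeeze} squeeze-injective))
  where
    y≢f : ∀ x → y ≢ f x
    y≢f x y≡fx = y∉im (x , sym y≡fx)
    squeeze : Fin (suc n) → Fin n
    squeeze x = punchOut (y≢f x)
    squeeze-injective : Injective _≡_ _≡_ squeeze
    squeeze-injective eq = f-inj (punchOut-injective (y≢f _) (y≢f _) eq)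

IncreasingOnBlocks : ∀ {K} → (ℕ → ℕ) → Vec (Fin K) K → Set
IncreasingOnBlocks {K} key lab = ∀ (p q : Fin K) → toℕ p < toℕ q → key (toℕ p) ≡ key (toℕ q) →
                                 toℕ (lookup lab p) < toℕ (lookup lab q)

module Relabel {k : ℕ} {key : ℕ → ℕ} (key-mono : MonotoneUpTo k key)
  (lab : Vec (Fin (suc k)) (suc k)) (lab-injective : Injective _≡_ _≡_ (lookup lab)) where

  private
    K = suc k

    ≤k : (i : Fin K) → toℕ i ≤ k
    ≤k i = ≤-pred (toℕ<n i)

    key-⊓ : ∀ {i x} → key x ≡ key i → key (i ⊓ x) ≡ key i
    key-⊓ {i} {x} e with ⊓-sel i x
    ... | inj₁ i⊓x≡i rewrite i⊓x≡i = refl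
    ... | inj₂ i⊓x≡x rewrite i⊓x≡x = e

    key-⊔ : ∀ {i x} → key x ≡ key i → key (i ⊔ x) ≡ key i
    key-⊔ {i} {x} e with ⊔-sel i x
    ... | inj₁ i⊔x≡i rewrite i⊔x≡i = refl
    ... | inj₂ i⊔x≡x rewrite i⊔x≡x = e

  sameBlock⇒key≡ : ∀ i x → T (sameBlock key i x) → key (toℕ x) ≡ key (toℕ i)
  sameBlock⇒key≡ i x h with All.lookup (all⁺ _ (allFin K) h) (∈-allFin x)
  ... | between
    rewrite T⇒≡true (inRange⁺ {toℕ i ⊓ toℕ x} {toℕ x} {toℕ i ⊔ toℕ x} (m⊓n≤n _ _) (m≤n⊔m _ _)) =
    ≡ᵇ⇒≡ _ _ between

  -- By monotonicity the key is constant between two indices with equal keys.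
  key≡⇒sameBlock : ∀ i x → key (toℕ x) ≡ key (toℕ i) → T (sameBlock key i x)
  key≡⇒sameBlock i x e = all⁻ _ (All.tabulate between)
    where
      lo = toℕ i ⊓ toℕ x
      hi = toℕ i ⊔ toℕ x
      between : ∀ {t} → t ∈ allFin K →
                T (if inRange lo (toℕ t) hi then key (toℕ t) ≡ᵇ key (toℕ i) else true)
      between {t} _ with inRange lo (toℕ t) hi in inR
      ... | false = _
      ... | true  = let lo≤t , t≤hi = inRange⁻ (≡true⇒T inR) in
        ≡⇒≡ᵇ _ _ (≤-antisym
          (subst (key (toℕ t) ≤_) (key-⊔ e) (key-mono t≤hi (⊔-lub (≤k i) (≤k x))))
          (subst (_≤ key (toℕ t)) (key-⊓ e) (key-mono lo≤t (≤k t))))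

  block : Fin K → List (Fin K)
  block i = filterᵇ (sameBlock key i) (allFin K)

  rank : Fin K → ℕ
  rank i = length (filterᵇ (λ i' → toℕ i' <ᵇ toℕ i) (block i))

  blockLabels : Fin K → List (Fin K)
  blockLabels i = sortF (List.map (lookup lab) (block i))

  lookup-relabel : ∀ i → lookup (relabel key lab) i ≡ nth fzero (blockLabels i) (rank i)
  lookup-relabel = lookup∘tabulate _

  ∈-block⁻ : ∀ i {x} → x ∈ block i → key (toℕ x) ≡ key (toℕ i)
  ∈-block⁻ i {x} x∈ = sameBlock⇒key≡ i x (proj₂ (∈-filter⁻ (T? ∘ sameBlock key i) x∈))

  ∈-block⁺ : ∀ i {x} → key (toℕ x) ≡ key (toℕ i) → x ∈ block i
  ∈-block⁺ i {x} e = ∈-filter⁺ (T? ∘ sameBlock key i) (∈-allFin x) (key≡⇒sameBlock i x e)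

  block-≡ : ∀ {i i'} → key (toℕ i) ≡ key (toℕ i') → block i ≡ block i'
  block-≡ {i} {i'} e = filter-≐ (T? ∘ sameBlock key i) (T? ∘ sameBlock key i')
    ( (λ {x} h → key≡⇒sameBlock i' x (trans (sameBlock⇒key≡ i x h) e))
    , (λ {x} h → key≡⇒sameBlock i x (trans (sameBlock⇒key≡ i' x h) (sym e))))
    (allFin K)

  blockLabels-sorted : ∀ i → Sorted (blockLabels i)
  blockLabels-sorted i = sortF-sorted _
    (Unique.map⁺ lab-injective (Unique.filter⁺ (T? ∘ sameBlock key i) (Unique.allFin⁺ K)))

  rank<length : ∀ i → rank i < length (blockLabels i)
  rank<length i = begin-strict
    rank i                                        <⟨ length-filterᵇ-< _ (λ _ → true) (block i) _
                                                       (∈-block⁺ i refl) (<ᵇ-irrefl (toℕ i)) refl ⟩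
    length (filterᵇ (λ _ → true) (block i))       ≡⟨ cong length (filter-all (T? ∘ λ _ → true)
                                                                           (All.universal _ (block i))) ⟩
    length (block i)                              ≡⟨ length-map (lookup lab) (block i) ⟨
    length (List.map (lookup lab) (block i))      ≡⟨ length-sortF (List.map (lookup lab) (block i)) ⟨
    length (blockLabels i)                        ∎
    where open ≤-Reasoning

  rank-strictMono : ∀ {i i'} → toℕ i < toℕ i' → key (toℕ i) ≡ key (toℕ i') → rank i < rank i'
  rank-strictMono {i} {i'} i<i' e rewrite block-≡ {i} {i'} e =
    length-filterᵇ-< (λ z → toℕ z <ᵇ toℕ i) (λ z → toℕ z <ᵇ toℕ i') (block i')
      (λ _ z<i → <⇒<ᵇ (<-trans (<ᵇ⇒< _ _ z<i) i<i'))
      (∈-block⁺ i' e) (<ᵇ-irrefl (toℕ i)) (T⇒≡true (<⇒<ᵇ i<i'))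

  relabel-increasing : IncreasingOnBlocks key (relabel key lab)
  relabel-increasing i i' i<i' e rewrite lookup-relabel i | lookup-relabel i' =
    subst (λ ls → toℕ (nth fzero (blockLabels i) (rank i)) < toℕ (nth fzero ls (rank i'))) labels≡
      (nth-strictMono fzero (blockLabels i) (blockLabels-sorted i) (rank-strictMono i<i' e)
        (subst (λ ls → rank i' < length ls) (sym labels≡) (rank<length i')))
    where
      labels≡ : blockLabels i ≡ blockLabels i'
      labels≡ = cong (λ b → sortF (List.map (lookup lab) b)) (block-≡ e)

  relabel-from-block : ∀ i → ∃[ p ] (p ∈ block i × lookup (relabel key lab) i ≡ lookup lab p)
  relabel-from-block i =
    let p , p∈ , e = ∈-map⁻ (lookup lab) (∈-sortF⁻ _ (nth-∈ fzero (blockLabels i) (rank<length i)))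
    in p , p∈ , trans (lookup-relabel i) e

  relabel-≡⇒key≡ : ∀ {i i'} → lookup (relabel key lab) i ≡ lookup (relabel key lab) i' →
                   key (toℕ i) ≡ key (toℕ i')
  relabel-≡⇒key≡ {i} {i'} eq with relabel-from-block i | relabel-from-block i'
  ... | p , p∈ , e | p' , p'∈ , e' =
    trans (sym (∈-block⁻ i p∈)) (trans (cong (key ∘ toℕ) (lab-injective (trans (sym e) (trans eq e'))))
                                       (∈-block⁻ i' p'∈))

  relabel-injective : Injective _≡_ _≡_ (lookup (relabel key lab))
  relabel-injective {i} {i'} eq with <-cmp (toℕ i) (toℕ i')
  ... | tri≈ _ i≡i' _ = toℕ-injective i≡i'
  ... | tri< i<i' _ _ =
    ⊥-elim (<-irrefl (cong toℕ eq) (relabel-increasing i i' i<i' (relabel-≡⇒key≡ eq)))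
  ... | tri> _ _ i'<i =
    ⊥-elim (<-irrefl (cong toℕ (sym eq)) (relabel-increasing i' i i'<i (relabel-≡⇒key≡ (sym eq))))

  relabel-bijective : Bijective _≡_ _≡_ (lookup (relabel key lab))
  relabel-bijective = relabel-injective , injective⇒surjective _ relabel-injective

  -- Index 0 has rank 0 in its block, so it gets the least label of the block, which is ≤ lab 0.
  relabel-zero : lookup lab fzero ≡ fzero → lookup (relabel key lab) fzero ≡ fzero
  relabel-zero lab0 = trans (lookup-relabel fzero) (trans (cong (nth fzero (blockLabels fzero)) rank-zero)
    (toℕ-injective (n≤0⇒n≡0 (nth-zero-≤ fzero (blockLabels fzero) (blockLabels-sorted fzero)
      (∈-sortF⁺ _ (subst (_∈ List.map (lookup lab) (block fzero)) lab0
                          (∈-map⁺ (lookup lab) (∈-block⁺ fzero refl))))))))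
    where
      rank-zero : rank fzero ≡ 0
      rank-zero = cong length (filter-none (T? ∘ λ i' → toℕ i' <ᵇ 0) (All.universal (λ _ ()) (block fzero)))

posOf-lookup : ∀ {k} (lab : Vec (Fin k) k) → Injective _≡_ _≡_ (lookup lab) →
               ∀ i → posOf lab (toℕ (lookup lab i)) ≡ toℕ i
posOf-lookup lab lab-injective i = firstTrue-unique v hit miss
  where
    f = λ y → toℕ y ≡ᵇ toℕ (lookup lab i)
    v = map f lab
    vget-v : ∀ j → vget false v (toℕ j) ≡ f (lookup lab j)
    vget-v j = trans (vget-lookup false v j) (lookup-map j f lab)
    hit : vget false v (toℕ i) ≡ true
    hit = trans (vget-v i) (T⇒≡true (≡⇒≡ᵇ (toℕ (lookup lab i)) _ refl))
    miss : ∀ {j} → j < toℕ i → vget false v j ≡ false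
    miss {j} j<i = trans (cong (vget false v) (sym toℕ-j')) (trans (vget-v j')
      (¬-not (λ e → <-irrefl (trans (sym toℕ-j') (cong toℕ (lab-injective (toℕ-injective (≡ᵇ⇒≡ _ _ (≡true⇒T e))))))
                             j<i)))
      where
        j<k = <-trans j<i (toℕ<n i)
        j'  = fromℕ< j<k
        toℕ-j' = toℕ-fromℕ< j<k

strictMono⇒inflationary : ∀ {K} (g : Fin K → Fin K) → g Preserves Fin._<_ ⟶ Fin._<_ →
                          ∀ p → toℕ p ≤ toℕ (g p)
strictMono⇒inflationary {K} g g-mono p = go (toℕ p) p refl
  where
    go : ∀ n (p : Fin K) → toℕ p ≡ n → n ≤ toℕ (g p)
    go zero    p _ = z≤n
    go (suc n) p e = ≤-trans (s≤s (go n p' (toℕ-fromℕ< n<K))) (g-mono p'<p)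
      where
        n<K : n < K
        n<K = <-trans (n<1+n n) (subst (_< K) e (toℕ<n p))
        p' = fromℕ< n<K
        p'<p : p' Fin.< p
        p'<p = subst₂ _<_ (sym (toℕ-fromℕ< n<K)) (sym e) (n<1+n n)

record BlockLabelling (k : ℕ) (key : ℕ → ℕ) (lab : Vec (Fin (suc k)) (suc k)) : Set where
  field
    key-mono   : MonotoneUpTo k key
    bijective  : Bijective _≡_ _≡_ (lookup lab)
    increasing : IncreasingOnBlocks key lab

  injective : Injective _≡_ _≡_ (lookup lab)
  injective = proj₁ bijective

  index : Fin (suc k) → Fin (suc k)
  index x = proj₁ (proj₂ bijective x)

  lookup-index : ∀ x → lookup lab (index x) ≡ x
  lookup-index x = proj₂ (proj₂ bijective x) refl

  key-of : Fin (suc k) → ℕ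
  key-of x = key (posOf lab (toℕ x))

  key-of-lookup : ∀ p → key-of (lookup lab p) ≡ key (toℕ p)
  key-of-lookup p = cong key (posOf-lookup lab injective p)

module Transfer {k key₁ key₂ lab₁ lab₂}
  (L₁ : BlockLabelling k key₁ lab₁) (L₂ : BlockLabelling k key₂ lab₂)
  (same-keys : ∀ x → BlockLabelling.key-of L₁ x ≡ BlockLabelling.key-of L₂ x) where
  private
    module L₁ = BlockLabelling L₁
    module L₂ = BlockLabelling L₂

  transfer : Fin (suc k) → Fin (suc k)
  transfer p = L₂.index (lookup lab₁ p)

  lookup-transfer : ∀ p → lookup lab₂ (transfer p) ≡ lookup lab₁ p
  lookup-transfer p = L₂.lookup-index _

  key-transfer : ∀ p → key₂ (toℕ (transfer p)) ≡ key₁ (toℕ p)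
  key-transfer p = begin
    key₂ (toℕ (transfer p))              ≡⟨ L₂.key-of-lookup (transfer p) ⟨
    L₂.key-of (lookup lab₂ (transfer p)) ≡⟨ cong L₂.key-of (lookup-transfer p) ⟩
    L₂.key-of (lookup lab₁ p)            ≡⟨ same-keys _ ⟨
    L₁.key-of (lookup lab₁ p)            ≡⟨ L₁.key-of-lookup p ⟩
    key₁ (toℕ p)                         ∎
    where open ≡-Reasoning

  -- Keys are weakly increasing on both sides, and labels break ties the same way on both sides.
  transfer-strictMono : transfer Preserves Fin._<_ ⟶ Fin._<_
  transfer-strictMono {p} {q} p<q with <-cmp (toℕ (transfer p)) (toℕ (transfer q))
  ... | tri< tp<tq _ _ = tp<tq
  ... | tri≈ _ tp≡tq _ = ⊥-elim (<-irrefl (cong toℕ (L₁.injective (begin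
          lookup lab₁ p             ≡⟨ lookup-transfer p ⟨
          lookup lab₂ (transfer p)  ≡⟨ cong (lookup lab₂) (toℕ-injective tp≡tq) ⟩
          lookup lab₂ (transfer q)  ≡⟨ lookup-transfer q ⟩
          lookup lab₁ q             ∎))) p<q)
    where open ≡-Reasoning
  ... | tri> _ _ tq<tp = ⊥-elim (<-asym (L₁.increasing p q p<q keys≡)
          (subst₂ (λ x y → toℕ x < toℕ y) (lookup-transfer q) (lookup-transfer p)
            (L₂.increasing (transfer q) (transfer p) tq<tp
              (trans (key-transfer q) (trans (sym keys≡) (sym (key-transfer p)))))))
    where
      keys≡ : key₁ (toℕ p) ≡ key₁ (toℕ q)
      keys≡ = ≤-antisym (L₁.key-mono (<⇒≤ p<q) (≤-pred (toℕ<n q)))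
                (subst₂ _≤_ (key-transfer q) (key-transfer p)
                            (L₂.key-mono (<⇒≤ tq<tp) (≤-pred (toℕ<n (transfer p)))))

-- Both transfers are inflationary and inverse to each other, hence the identity.
labelling-unique : ∀ {k key₁ key₂ lab₁ lab₂} → BlockLabelling k key₁ lab₁ → BlockLabelling k key₂ lab₂ →
  (∀ x → key₁ (posOf lab₁ (toℕ x)) ≡ key₂ (posOf lab₂ (toℕ x))) →
  lab₁ ≡ lab₂ × (∀ p → key₁ (toℕ p) ≡ key₂ (toℕ p))
labelling-unique {key₁ = key₁} {key₂} {lab₁} {lab₂} L₁ L₂ same-keys =
  lab≡ , λ p → trans (sym (key-transfer p)) (cong (key₂ ∘ toℕ) (transfer≡id p))
  where
    open Transfer L₁ L₂ same-keys
    open Transfer L₂ L₁ (sym ∘ same-keys) using ()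
      renaming ( transfer to transfer⁻¹; lookup-transfer to lookup-transfer⁻¹
               ; transfer-strictMono to transfer⁻¹-strictMono)

    transfer⁻¹∘transfer : ∀ p → transfer⁻¹ (transfer p) ≡ p
    transfer⁻¹∘transfer p =
      BlockLabelling.injective L₁ (trans (lookup-transfer⁻¹ (transfer p)) (lookup-transfer p))

    transfer≡id : ∀ p → transfer p ≡ p
    transfer≡id p = toℕ-injective (≤-antisym
      (subst (λ z → toℕ (transfer p) ≤ toℕ z) (transfer⁻¹∘transfer p)
             (strictMono⇒inflationary transfer⁻¹ transfer⁻¹-strictMono (transfer p)))
      (strictMono⇒inflationary transfer transfer-strictMono p))

    lab≡ : lab₁ ≡ lab₂
    lab≡ = begin
      lab₁                            ≡⟨ tabulate∘lookup lab₁ ⟨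
      tabulate (lookup lab₁)          ≡⟨ tabulate-cong (λ p → trans (sym (lookup-transfer p))
                                                                   (cong (lookup lab₂) (transfer≡id p))) ⟩
      tabulate (lookup lab₂)          ≡⟨ tabulate∘lookup lab₂ ⟩
      lab₂                            ∎
      where open ≡-Reasoning

parallelogram-⊆ : ∀ {m' n'} {P Q : Tab (suc m') (suc n')} → IsParallelogram P → IsParallelogram Q →
  (∀ {i} → i ≤ m' → leftmost Q i ≤ leftmost P i) → (∀ {j} → j ≤ n' → topmost Q j ≤ topmost P j) →
  ∀ {i j} → entry P i j ≡ true → entry Q i j ≡ true
parallelogram-⊆ isP isQ left≤ top≤ e =
  Q.leftmost-topmost⇒entry i≤m' j≤n' (≤-trans (left≤ i≤m') (P.entry⇒leftmost≤ e))
                                     (≤-trans (top≤ j≤n') (P.entry⇒topmost≤ e))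
  where
    module P = Parallelogram isP
    module Q = Parallelogram isQ
    i≤m' = P.entry⇒row≤ e
    j≤n' = P.entry⇒col≤ e

parallelogram-ext : ∀ {m' n'} {P Q : Tab (suc m') (suc n')} → IsParallelogram P → IsParallelogram Q →
  (∀ {i} → i ≤ m' → leftmost P i ≡ leftmost Q i) → (∀ {j} → j ≤ n' → topmost P j ≡ topmost Q j) →
  P ≡ Q
parallelogram-ext {P = P} {Q} isP isQ left≡ top≡ = Tab-ext P Q λ i j → ≡true-ext
  (parallelogram-⊆ isP isQ (≤-reflexive ∘ sym ∘ left≡) (≤-reflexive ∘ sym ∘ top≡))
  (parallelogram-⊆ isQ isP (≤-reflexive ∘ left≡) (≤-reflexive ∘ top≡))

pointwise-upTo : ∀ {k} {f g : ℕ → ℕ} → (∀ (p : Fin (suc k)) → f (toℕ p) ≡ g (toℕ p)) →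
                 ∀ {i} → i ≤ k → f i ≡ g i
pointwise-upTo {f = f} {g} f≡g i≤k =
  subst (λ z → f z ≡ g z) (toℕ-fromℕ< (s≤s i≤k)) (f≡g (fromℕ< (s≤s i≤k)))

tabulate-injective : ∀ {A : Set} {n} {f g : Fin n → A} → tabulate f ≡ tabulate g → ∀ i → f i ≡ g i
tabulate-injective {f = f} {g} eq i = begin
  f i                   ≡⟨ lookup∘tabulate f i ⟨
  lookup (tabulate f) i ≡⟨ cong (λ v → lookup v i) eq ⟩
  lookup (tabulate g) i ≡⟨ lookup∘tabulate g i ⟩
  g i                   ∎
  where open ≡-Reasoning

subtrahend-unique : ∀ {a a' b c} → a ≡ a' → + a - + b ≡ + a' - + c → b ≡ c
subtrahend-unique {a} refl eq = +-injective (neg-injective (∙-cancelˡ (+ a) _ _ eq))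

module _ {m' n' : ℕ} where

  IsLPara⇒rowLabelling : ∀ {D : LTab (suc m') (suc n')} → IsLPara D →
                         BlockLabelling m' (leftmost (tab D)) (rowLab D)
  IsLPara⇒rowLabelling isD = record
    { key-mono = Parallelogram.leftmost-mono para ; bijective = rowPerm ; increasing = rowIncr }
    where open IsLPara isD

  IsLPara⇒colLabelling : ∀ {D : LTab (suc m') (suc n')} → IsLPara D →
                         BlockLabelling n' (topmost (tab D)) (colLab D)
  IsLPara⇒colLabelling isD = record
    { key-mono = Parallelogram.topmost-mono para ; bijective = colPerm ; increasing = colIncr }
    where open IsLPara isD

  leftmost-row-v₀ : ∀ {D : LTab (suc m') (suc n')} → IsLPara D →
                    leftmost (tab D) (posOf (rowLab D) 0) ≡ 0
  leftmost-row-v₀ {D} isD = trans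
    (cong (leftmost (tab D)) (subst (λ x → posOf (rowLab D) (toℕ x) ≡ 0) topLabel
                                    (posOf-lookup (rowLab D) (proj₁ rowPerm) fzero)))
    (Parallelogram.leftmost-top para)
    where open IsLPara isD

  module _ {D₁ D₂ : LTab (suc m') (suc n')} (B≡ : B D₁ ≡ B D₂) (surp≡ : surp D₁ ≡ surp D₂) where
    private
      rows₁ = tabulate {m'} (surpRow D₁ ∘ suc ∘ toℕ)
      rows₂ = tabulate {m'} (surpRow D₂ ∘ suc ∘ toℕ)

    -- surp_i is the difference of these columns in B D and in D, and B D is shared.
    row-keys≡ : IsLPara D₁ → IsLPara D₂ → ∀ (x : Fin (suc m')) →
                leftmost (tab D₁) (posOf (rowLab D₁) (toℕ x)) ≡ leftmost (tab D₂) (posOf (rowLab D₂) (toℕ x))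
    row-keys≡ isD₁ isD₂ fzero    = trans (leftmost-row-v₀ isD₁) (sym (leftmost-row-v₀ isD₂))
    row-keys≡ isD₁ isD₂ (fsuc k) = subtrahend-unique
      (cong (λ E → leftmost (tab E) (posOf (rowLab E) (suc (toℕ k)))) B≡)
      (tabulate-injective (++-injectiveˡ rows₁ rows₂ surp≡) k)

    col-keys≡ : ∀ (x : Fin (suc n')) →
                topmost (tab D₁) (posOf (colLab D₁) (toℕ x)) ≡ topmost (tab D₂) (posOf (colLab D₂) (toℕ x))
    col-keys≡ x = subtrahend-unique
      (cong (λ E → topmost (tab E) (posOf (colLab E) (toℕ x))) B≡)
      (tabulate-injective {f = surpCol D₁ ∘ toℕ} {surpCol D₂ ∘ toℕ} (++-injectiveʳ rows₁ rows₂ surp≡) x)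

B-isLRib : ∀ {m' n'} (D : LTab (suc m') (suc n')) → IsLPara D → IsLRib (B D)
B-isLRib (T , rl , cl) isD = record
  { lpara = record
    { para     = isParallelogram
    ; rowPerm  = Rows.relabel-bijective
    ; colPerm  = Cols.relabel-bijective
    ; topLabel = Rows.relabel-zero topLabel
    ; rowIncr  = Rows.relabel-increasing
    ; colIncr  = Cols.relabel-increasing
    }
  ; ribbon = ones≡
  }
  where
    open IsLPara isD
    open Bounce para
    module Ribbon = Parallelogram isParallelogram
    module Rows = Relabel Ribbon.leftmost-mono rl (proj₁ rowPerm)
    module Cols = Relabel Ribbon.topmost-mono cl (proj₁ colPerm)

B-surp-injective : ∀ {m' n'} (D₁ D₂ : LTab (suc m') (suc n')) → IsLPara D₁ → IsLPara D₂ →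
                   B D₁ ≡ B D₂ → surp D₁ ≡ surp D₂ → D₁ ≡ D₂
B-surp-injective (T₁ , rl₁ , cl₁) (T₂ , rl₂ , cl₂) isD₁ isD₂ B≡ surp≡ =
  cong₂ _,_ (parallelogram-ext (IsLPara.para isD₁) (IsLPara.para isD₂)
                               (pointwise-upTo left≡) (pointwise-upTo top≡))
            (cong₂ _,_ rl≡ cl≡)
  where
    rows = labelling-unique (IsLPara⇒rowLabelling isD₁) (IsLPara⇒rowLabelling isD₂)
                            (row-keys≡ B≡ surp≡ isD₁ isD₂)
    cols = labelling-unique (IsLPara⇒colLabelling isD₁) (IsLPara⇒colLabelling isD₂) (col-keys≡ B≡ surp≡)
    rl≡   = proj₁ rows
    left≡ = proj₂ rows
    cl≡   = proj₁ cols
    top≡  = proj₂ cols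

proposition4p1 : (m' n' : ℕ) →
    ((D : LTab (suc m') (suc n')) → IsLPara D → IsLRib (B D))
    × ((D₁ D₂ : LTab (suc m') (suc n')) → IsLPara D₁ → IsLPara D₂ →
       B D₁ ≡ B D₂ → surp D₁ ≡ surp D₂ → D₁ ≡ D₂)
proposition4p1 m' n' = B-isLRib , B-surp-injective
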